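{- For every positive integer $n$, $|\mathcal G_3^n|\ge|\mathcal G_2^n|\cdot 3^{n(n-1)^2-1}$.
   Context: Let $P_\star=\{0,1,\star\}$ with $0\preceq\star$, $1\preceq\star$, $0,1$ incomparable. A $\star$-graph is a finite set $G$ with a map $E^{\mathbf G}\colon G^2\to P_\star$; a ternary $\star$-structure is a finite set $G$ with a map $R^{\mathbf G}\colon G^3\to P_\star$ (a $(\star,\tilde\sigma)$-structure for $\tilde\sigma=\{R\}$ ternary). A homomorphism $h\colon\mathbf G\to\mathbf H$ is a map $h\colon G\to H$ with $R^{\mathbf G}(\mathbf t)\preceq R^{\mathbf H}(h(\mathbf t))$ for all tuples $\mathbf t$. A structure is a core if all its endomorphisms are isomorphisms; two structures are homomorphically equivalent if each maps homomorphically to the other. $\mathcal G_2^n$ denotes a maximal family of $\star$-graphs on $n$ elements that are cores (having no element $x$ with $E(x,x)=\star$) and pairwise not homomorphically equivalent; $\mathcal G_3^n$ denotes the analogous family of ternary $\star$-structures on $n$ elements (cores with no $x$ such that $R(x,x,x)=\star$, pairwise not homomorphically equivalent). -}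

module Defs where

open import Data.Nat using (ℕ)
open import Data.Fin using (Fin)
open import Data.Product using (Σ; _×_; ∃)
open import Data.List using (List)
open import Data.List.Membership.Propositional using (_∈_)
open import Data.List.Relation.Unary.AllPairs using (AllPairs)
open import Relation.Nullary using (¬_)
open import Relation.Binary.PropositionalEquality using (_≡_)
open import Function using (_∘_)

data P⋆ : Set where
  p0 p1 star : P⋆

data _⪯_ : P⋆ → P⋆ → Set where
  ⪯-refl : ∀ {a} → a ⪯ a
  0⪯⋆    : p0 ⪯ star
  1⪯⋆    : p1 ⪯ star

-- A k-ary ⋆-structure on the n-element set Fin n:
-- a map R : (Fin n)^k → P⋆, k-tuples being functions Fin k → Fin n.
-- k = 2 gives ⋆-graphs, k = 3 ternary ⋆-structures.
Struct : ℕ → ℕ → Set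
Struct k n = (Fin k → Fin n) → P⋆

IsHom : ∀ {k n m} → Struct k n → Struct k m → (Fin n → Fin m) → Set
IsHom G H h = ∀ t → G t ⪯ H (h ∘ t)

IsIso : ∀ {k n m} → Struct k n → Struct k m → (Fin n → Fin m) → Set
IsIso G H h = IsHom G H h × Σ (Fin _ → Fin _) λ g →
  IsHom H G g × (∀ x → g (h x) ≡ x) × (∀ y → h (g y) ≡ y)

IsCore : ∀ {k n} → Struct k n → Set
IsCore G = ∀ h → IsHom G G h → IsIso G G h

HomEquiv : ∀ {k n m} → Struct k n → Struct k m → Set
HomEquiv G H = Σ _ (IsHom G H) × Σ _ (IsHom H G)

NoStarLoop : ∀ {k n} → Struct k n → Set
NoStarLoop {n = n} G = (x : Fin n) → ¬ (G (λ _ → x) ≡ star)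

Admissible : ∀ {k n} → Struct k n → Set
Admissible G = IsCore G × NoStarLoop G

-- Maximality: no admissible
-- structure can be added, i.e. every admissible structure is homomorphically
-- equivalent to some member.
record MaximalFamily (k n : ℕ) : Set where
  field
    members     : List (Struct k n)
    admissible  : ∀ {G} → G ∈ members → Admissible G
    pairwiseNE  : AllPairs (λ G H → ¬ HomEquiv G H) members
    maximal     : ∀ (G : Struct k n) → Admissible G →
                  ∃ λ H → H ∈ members × HomEquiv G H

{-# OPTIONS --safe #-}
module Submission where

-- Let the points be 0, …, n. A ⋆-graph G without ⋆-loops and a choice φ of the (n+1)n² values
-- R(a,b,c) with a ≠ b ≠ c determine a ternary structure: R(a,a,c) = G(a,c), and for a ≠ b,
-- R(a,b,b) is 0 or 1 according as a < b or a > b. Let h be a homomorphism between two such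
-- structures whose target graph has no ⋆-loop. If h x = h y for some x < y, the loop value at
-- h y lies above both R(x,y,y) = 0 and R(y,x,x) = 1, so it is ⋆; hence h is injective, then
-- strictly increasing, hence the identity. So every such structure is an admissible core, and
-- two of them are homomorphically equivalent only if their graphs are and their free values
-- coincide. Taking G among the members of 𝒢₂ and φ among the 3^((n+1)n²) choices gives pairwise
-- inequivalent admissible structures, with pairwise distinct representatives in 𝒢₃.

open import Defs
open import Data.Nat as ℕ using (ℕ; suc; _*_; _^_; _≤_; z≤n; s≤s)
open import Data.List using (List; length; lookup)
import Data.Nat.Properties as ℕ
open import Data.Fin as Fin
  using (Fin; inject₁; opposite; punchIn; punchOut; combine; remQuot; finToFun; funToFin)
  renaming (zero to fzero; suc to fsuc)
open import Data.Fin.Properties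
  using (toℕ<n; ≤̄⇒inject₁<; opposite-prop; opposite-involutive; toℕ-inject₁;
         punchInᵢ≢i; punchOut-cong; punchOut-punchIn; combine-remQuot;
         combine-surjective; funToFin-finToFin; injective⇒≤; <⇒≢; ≤-antisym; _≟_; _<?_; <-cmp)
open import Data.List.Relation.Unary.All as All using (All)
open import Data.List.Relation.Unary.AllPairs as AllPairs using (AllPairs)
open import Data.List.Relation.Unary.Any using (index)
open import Data.List.Relation.Unary.Any.Properties using (lookup-index)
open import Data.List.Membership.Propositional.Properties using (∈-lookup)
open import Data.Vec.Functional using ([]; _∷_)
open import Data.Product using (Σ; _×_; _,_; proj₁; proj₂; uncurry)
open import Relation.Nullary using (¬_; yes; no; contradiction)
open import Relation.Binary using (Symmetric; _Preserves_⟶_; tri<; tri≈; tri>)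
open import Relation.Binary.PropositionalEquality
open import Function using (_∘_; id; const)

⪯-trans : ∀ {a b c} → a ⪯ b → b ⪯ c → a ⪯ c
⪯-trans ⪯-refl q      = q
⪯-trans 0⪯⋆    ⪯-refl = 0⪯⋆
⪯-trans 1⪯⋆    ⪯-refl = 1⪯⋆

⪯-antisym : ∀ {a b} → a ⪯ b → b ⪯ a → a ≡ b
⪯-antisym ⪯-refl _ = refl

⪯-both⇒≡star : ∀ {v} → p0 ⪯ v → p1 ⪯ v → v ≡ star
⪯-both⇒≡star 0⪯⋆ _ = refl

IsHom-∘ : ∀ {k a b c} {G : Struct k a} {H : Struct k b} {K : Struct k c} {h g} →
          IsHom G H h → IsHom H K g → IsHom G K (g ∘ h)
IsHom-∘ G→H H→K t = ⪯-trans (G→H t) (H→K _)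

HomEquiv-sym : ∀ {k a b} {G : Struct k a} {H : Struct k b} → HomEquiv G H → HomEquiv H G
HomEquiv-sym (G→H , H→G) = H→G , G→H

HomEquiv-trans : ∀ {k a b c} {G : Struct k a} {H : Struct k b} {K : Struct k c} →
                 HomEquiv G H → HomEquiv H K → HomEquiv G K
HomEquiv-trans {G = G} {H} {K} ((h , G→H) , (h′ , H→G)) ((g , H→K) , (g′ , K→H)) =
  (g ∘ h , IsHom-∘ {G = G} {H} {K} {h} {g} G→H H→K) ,
  (h′ ∘ g′ , IsHom-∘ {G = K} {H} {G} {g′} {h′} K→H H→G)

inject₁-mono-< : ∀ {m} → inject₁ {m} Preserves Fin._<_ ⟶ Fin._<_
inject₁-mono-< {x = x} {y} x<y = subst₂ ℕ._<_ (sym (toℕ-inject₁ x)) (sym (toℕ-inject₁ y)) x<y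

opposite-anti-< : ∀ {m} {x y : Fin m} → x Fin.< y → opposite y Fin.< opposite x
opposite-anti-< {x = x} {y} x<y = subst₂ ℕ._<_ (sym (opposite-prop y)) (sym (opposite-prop x))
  (ℕ.∸-monoʳ-< (s≤s x<y) (toℕ<n y))

strictMono⇒inflationary : ∀ {m k} (f : Fin m → Fin k) → f Preserves Fin._<_ ⟶ Fin._<_ →
                          ∀ x → x Fin.≤ f x
strictMono⇒inflationary f mono fzero    = z≤n
strictMono⇒inflationary f mono (fsuc x) = ℕ.≤-trans
  (s≤s (strictMono⇒inflationary (f ∘ inject₁) (mono ∘ inject₁-mono-<) x))
  (mono (≤̄⇒inject₁< ℕ.≤-refl))

-- Conjugating by opposite turns the inflationary bound into a deflationary one.
strictMono⇒deflationary : ∀ {m} (f : Fin m → Fin m) → f Preserves Fin._<_ ⟶ Fin._<_ →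
                          ∀ x → f x Fin.≤ x
strictMono⇒deflationary f mono x = ℕ.≮⇒≥ λ x<fx → ℕ.<⇒≱ (opposite-anti-< x<fx) opposite-x≤opposite-fx
  where
  opposite-x≤opposite-fx : opposite x Fin.≤ opposite (f x)
  opposite-x≤opposite-fx = subst (λ z → opposite x Fin.≤ opposite (f z)) (opposite-involutive x)
    (strictMono⇒inflationary (opposite ∘ f ∘ opposite)
      (opposite-anti-< ∘ mono ∘ opposite-anti-<) (opposite x))

strictMono⇒≗id : ∀ {m} (f : Fin m → Fin m) → f Preserves Fin._<_ ⟶ Fin._<_ → ∀ x → f x ≡ x
strictMono⇒≗id f mono x =
  ≤-antisym (strictMono⇒deflationary f mono x) (strictMono⇒inflationary f mono x)

pairs-injective⇒≤ : ∀ {a b c} (f : Fin a → Fin b → Fin c) →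
                    (∀ {i k j l} → f i k ≡ f j l → i ≡ j × k ≡ l) → a * b ≤ c
pairs-injective⇒≤ {a} {b} f f-injective = injective⇒≤ {f = uncurry f ∘ remQuot {a} b} λ {p} {q} e →
  let i≡j , k≡l = f-injective e in begin
    p                                ≡⟨ combine-remQuot {a} b p ⟨
    uncurry combine (remQuot {a} b p) ≡⟨ cong₂ combine i≡j k≡l ⟩
    uncurry combine (remQuot {a} b q) ≡⟨ combine-remQuot {a} b q ⟩
    q                                ∎
  where open ≡-Reasoning

funToFin-cong : ∀ {m k} {f g : Fin m → Fin k} → (∀ x → f x ≡ g x) → funToFin f ≡ funToFin g
funToFin-cong {ℕ.zero}  f≗g = refl
funToFin-cong {ℕ.suc m} f≗g = cong₂ combine (f≗g fzero) (funToFin-cong (f≗g ∘ fsuc))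

finToFun-injective : ∀ {m k} {x y : Fin (k ^ m)} → (∀ i → finToFun {k} {m} x i ≡ finToFun y i) → x ≡ y
finToFun-injective {m} {k} {x} {y} x≗y = begin
  x                                      ≡⟨ funToFin-finToFin {m} {k} x ⟨
  funToFin {m} {k} (finToFun {k} {m} x) ≡⟨ funToFin-cong x≗y ⟩
  funToFin {m} {k} (finToFun {k} {m} y) ≡⟨ funToFin-finToFin {m} {k} y ⟩
  y                                      ∎
  where open ≡-Reasoning

AllPairs¬⇒lookup-injective : ∀ {A : Set} {R : A → A → Set} {xs : List A} → Symmetric R →
                             AllPairs (λ x y → ¬ R x y) xs →
                             ∀ {i j} → R (lookup xs i) (lookup xs j) → i ≡ j
AllPairs¬⇒lookup-injective R-sym (_ AllPairs.∷ _)   {fzero}  {fzero}  _ = refl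
AllPairs¬⇒lookup-injective R-sym (¬R AllPairs.∷ _)  {fzero}  {fsuc j} r =
  contradiction r (All.lookup ¬R (∈-lookup j))
AllPairs¬⇒lookup-injective R-sym (¬R AllPairs.∷ _)  {fsuc i} {fzero}  r =
  contradiction (R-sym r) (All.lookup ¬R (∈-lookup i))
AllPairs¬⇒lookup-injective R-sym (_ AllPairs.∷ ¬Rs) {fsuc i} {fsuc j} r =
  cong fsuc (AllPairs¬⇒lookup-injective R-sym ¬Rs r)

module _ {k m} (F : MaximalFamily k m) where
  open MaximalFamily F

  representative : ∀ G → Admissible G → Σ (Fin (length members)) λ i → HomEquiv G (lookup members i)
  representative G G-admissible with H , H∈ , G≈H ← maximal G G-admissible =
    index H∈ , subst (HomEquiv G) (lookup-index H∈) G≈H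

  member-noStarLoop : ∀ i → NoStarLoop (lookup members i)
  member-noStarLoop i = proj₂ (admissible (∈-lookup i))

  member-homEquiv⇒≡ : ∀ {i j} → HomEquiv (lookup members i) (lookup members j) → i ≡ j
  member-homEquiv⇒≡ = AllPairs¬⇒lookup-injective HomEquiv-sym pairwiseNE

module Ternary (n : ℕ) where

  Point : Set
  Point = Fin (suc n)

  -- φ b x y is the value at the triple (punchIn b x, b, punchIn b y).
  Free : Set
  Free = Point → Fin n → Fin n → P⋆

  order : Point → Point → P⋆
  order a b with a <? b
  ... | yes _ = p0
  ... | no  _ = p1

  order-< : ∀ {a b} → a Fin.< b → order a b ≡ p0
  order-< {a} {b} a<b with a <? b
  ... | yes _   = refl
  ... | no  a≮b = contradiction a<b a≮b

  order-> : ∀ {a b} → b Fin.< a → order a b ≡ p1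
  order-> {a} {b} b<a with a <? b
  ... | yes a<b = contradiction b<a (ℕ.<-asym a<b)
  ... | no  _   = refl

  p0⪯order⇒< : ∀ {a b} → p0 ⪯ order a b → a Fin.< b
  p0⪯order⇒< {a} {b} p0⪯ with a <? b
  ... | yes a<b = a<b

  ternaryAt : (a b c : Point) → P⋆ → Free → P⋆
  ternaryAt a b c g φ with a ≟ b | b ≟ c
  ... | yes _   | _       = g
  ... | no  a≢b | yes _   = order a b
  ... | no  a≢b | no  b≢c = φ b (punchOut (a≢b ∘ sym)) (punchOut b≢c)

  ternary : Struct 2 (suc n) → Free → Struct 3 (suc n)
  ternary G φ t = ternaryAt (t fzero) (t (fsuc fzero)) (t (fsuc (fsuc fzero))) (G (t ∘ fsuc)) φ

  ternaryAt-diag : ∀ {a b c g φ} → a ≡ b → ternaryAt a b c g φ ≡ g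
  ternaryAt-diag {a} {b} {c} a≡b with a ≟ b
  ... | yes _   = refl
  ... | no  a≢b = contradiction a≡b a≢b

  ternaryAt-free : ∀ {a b′ c g φ} b x y → a ≡ punchIn b x → b′ ≡ b → c ≡ punchIn b y →
                ternaryAt a b′ c g φ ≡ φ b x y
  ternaryAt-free {g = g} {φ} b x y refl refl refl with punchIn b x ≟ b | b ≟ punchIn b y
  ... | yes a≡b | _       = contradiction a≡b (punchInᵢ≢i b x)
  ... | no  _   | yes b≡c = contradiction (sym b≡c) (punchInᵢ≢i b y)
  ... | no  _   | no  _   = cong₂ (φ b)
    (trans (punchOut-cong b refl) (punchOut-punchIn b))
    (trans (punchOut-cong b refl) (punchOut-punchIn b))

  ternary-diag : ∀ {G φ} t → ternary G φ (t fzero ∷ t) ≡ G t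
  ternary-diag t = ternaryAt-diag {t fzero} {t fzero} {t (fsuc fzero)} refl

  ternary-collapse : ∀ {G φ a b} → a ≡ b → ternary G φ (a ∷ const b) ≡ G (const b)
  ternary-collapse {a = a} {b} = ternaryAt-diag {a} {b} {b}

  ternary-order : ∀ {G φ a b} → a ≢ b → ternary G φ (a ∷ const b) ≡ order a b
  ternary-order {a = a} {b} a≢b with a ≟ b | b ≟ b
  ... | yes a≡b | _       = contradiction a≡b a≢b
  ... | no  _   | yes _   = refl
  ... | no  _   | no  b≢b = contradiction refl b≢b

  module _ {G G′ φ φ′} {h : Point → Point} (hom : IsHom (ternary G φ) (ternary G′ φ′) h) where

    hom-graph : IsHom G G′ h
    hom-graph t =
      subst₂ _⪯_ (ternary-diag {G} {φ} t) (ternary-diag {G′} {φ′} (h ∘ t)) (hom (t fzero ∷ t))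

    module _ (G′-noStarLoop : NoStarLoop G′) where

      no-collapse : ∀ {x y} → x Fin.< y → h x ≢ h y
      no-collapse {x} {y} x<y hx≡hy = G′-noStarLoop (h y) (⪯-both⇒≡star p0⪯loop p1⪯loop)
        where
        p0⪯loop : p0 ⪯ G′ (const (h y))
        p0⪯loop = subst₂ _⪯_
          (trans (ternary-order {G} {φ} (<⇒≢ x<y)) (order-< x<y))
          (ternary-collapse {G′} {φ′} hx≡hy)
          (hom (x ∷ const y))
        p1⪯loop : p1 ⪯ G′ (const (h y))
        p1⪯loop = subst₂ _⪯_
          (trans (ternary-order {G} {φ} (<⇒≢ x<y ∘ sym)) (order-> x<y))
          (trans (ternary-collapse {G′} {φ′} (sym hx≡hy)) (cong (G′ ∘ const) hx≡hy))
          (hom (y ∷ const x))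

      hom-injective : ∀ {x y} → h x ≡ h y → x ≡ y
      hom-injective {x} {y} hx≡hy with <-cmp x y
      ... | tri< x<y _   _ = contradiction hx≡hy (no-collapse x<y)
      ... | tri≈ _   x≡y _ = x≡y
      ... | tri> _   _ y<x = contradiction (sym hx≡hy) (no-collapse y<x)

      hom-strictMono : h Preserves Fin._<_ ⟶ Fin._<_
      hom-strictMono {x} {y} x<y = p0⪯order⇒< (subst₂ _⪯_
        (trans (ternary-order {G} {φ} (<⇒≢ x<y)) (order-< x<y))
        (ternary-order {G′} {φ′} (<⇒≢ x<y ∘ hom-injective))
        (hom (x ∷ const y)))

      hom≗id : ∀ x → h x ≡ x
      hom≗id = strictMono⇒≗id h hom-strictMono

      hom-free : ∀ b x y → φ b x y ⪯ φ′ b x y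
      hom-free b x y = subst₂ _⪯_
        (ternaryAt-free b x y refl refl refl)
        (ternaryAt-free b x y (hom≗id _) (hom≗id _) (hom≗id _))
        (hom (punchIn b x ∷ b ∷ punchIn b y ∷ []))

  ternary-admissible : ∀ G φ → NoStarLoop G → Admissible (ternary G φ)
  ternary-admissible G φ G-noStarLoop = isCore , noStarLoop
    where
    isCore : IsCore (ternary G φ)
    isCore h hom = hom , id , (λ _ → ⪯-refl) , h≗id , h≗id
      where
      h≗id : ∀ x → h x ≡ x
      h≗id = hom≗id {G} {G} {φ} {φ} {h} hom G-noStarLoop
    noStarLoop : NoStarLoop (ternary G φ)
    noStarLoop x = G-noStarLoop x ∘ trans (sym (ternary-diag {G} {φ} (const x)))

  ternary-homEquiv⇒ : ∀ {G G′ φ φ′} → NoStarLoop G → NoStarLoop G′ →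
                      HomEquiv (ternary G φ) (ternary G′ φ′) →
                      HomEquiv G G′ × (∀ b x y → φ b x y ≡ φ′ b x y)
  ternary-homEquiv⇒ {G} {G′} {φ} {φ′} G-noStarLoop G′-noStarLoop ((h , hom) , (h′ , hom′)) =
    ((h , hom-graph {G} {G′} {φ} {φ′} {h} hom) , (h′ , hom-graph {G′} {G} {φ′} {φ} {h′} hom′)) ,
    λ b x y → ⪯-antisym (hom-free {G} {G′} {φ} {φ′} {h} hom G′-noStarLoop b x y)
                        (hom-free {G′} {G} {φ′} {φ} {h′} hom′ G-noStarLoop b x y)

  toP⋆ : Fin 3 → P⋆
  toP⋆ fzero               = p0
  toP⋆ (fsuc fzero)        = p1
  toP⋆ (fsuc (fsuc fzero)) = star

  fromP⋆ : P⋆ → Fin 3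
  fromP⋆ p0   = fzero
  fromP⋆ p1   = fsuc fzero
  fromP⋆ star = fsuc (fsuc fzero)

  fromP⋆-toP⋆ : ∀ i → fromP⋆ (toP⋆ i) ≡ i
  fromP⋆-toP⋆ fzero               = refl
  fromP⋆-toP⋆ (fsuc fzero)        = refl
  fromP⋆-toP⋆ (fsuc (fsuc fzero)) = refl

  decode : Fin (3 ^ (suc n * (n * n))) → Free
  decode k b x y = toP⋆ (finToFun k (combine b (combine x y)))

  decode-injective : ∀ {k l} → (∀ b x y → decode k b x y ≡ decode l b x y) → k ≡ l
  decode-injective {k} {l} k≗l = finToFun-injective {suc n * (n * n)} {3} agree
    where
    agree : ∀ i → finToFun k i ≡ finToFun l i
    agree i with combine-surjective {suc n} {n * n} i
    ... | b , r , refl with combine-surjective {n} {n} r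
    ... | x , y , refl =
      trans (sym (fromP⋆-toP⋆ _)) (trans (cong fromP⋆ (k≗l b x y)) (fromP⋆-toP⋆ _))

mainTheorem8 : ∀ (n : ℕ) → (F₂ : MaximalFamily 2 (suc n)) → (F₃ : MaximalFamily 3 (suc n)) →
    length (MaximalFamily.members F₂) * 3 ^ (suc n * (n * n))
      ≤ 3 * length (MaximalFamily.members F₃)
mainTheorem8 n F₂ F₃ = ℕ.≤-trans (pairs-injective⇒≤ code code-injective) (ℕ.m≤n*m _ 3)
  where
  open Ternary n
  open MaximalFamily F₂ using () renaming (members to graphs)
  open MaximalFamily F₃ using () renaming (members to structures)

  structure : Fin (length graphs) → Fin (3 ^ (suc n * (n * n))) → Struct 3 (suc n)
  structure i k = ternary (lookup graphs i) (decode k)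

  represent : ∀ i k → Σ (Fin (length structures)) λ c → HomEquiv (structure i k) (lookup structures c)
  represent i k = representative F₃ (structure i k)
    (ternary-admissible (lookup graphs i) (decode k) (member-noStarLoop F₂ i))

  code : Fin (length graphs) → Fin (3 ^ (suc n * (n * n))) → Fin (length structures)
  code i k = proj₁ (represent i k)

  code-injective : ∀ {i k j l} → code i k ≡ code j l → i ≡ j × k ≡ l
  code-injective {i} {k} {j} {l} same-code =
    let graphs≈ , decode≗ = ternary-homEquiv⇒ {lookup graphs i} {lookup graphs j} {decode k} {decode l}
          (member-noStarLoop F₂ i) (member-noStarLoop F₂ j) structures≈
    in member-homEquiv⇒≡ F₂ graphs≈ , decode-injective decode≗
    where
    structures≈ : HomEquiv (structure i k) (structure j l)
    structures≈ = HomEquiv-trans (proj₂ (represent i k)) (HomEquiv-sym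
      (subst (HomEquiv (structure j l) ∘ lookup structures) (sym same-code) (proj₂ (represent j l))))
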